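{- Let $p$ be a selective ultrafilter on $\omega$, let $Z$ be a set, and let $\langle u_n : n<\omega\rangle$ and $\langle v_n : n<\omega\rangle$ be two $p$-injective sequences of ultrafilters on $Z$. Then $p\text{ - }\lim_n u_n=p\text{ - }\lim_n v_n$ if and only if $\{n<\omega : u_n=v_n\}\in p$.
   Context: A nonprincipal ultrafilter $p$ on $\omega$ is selective if for every partition $\omega=\bigcup_{n<\omega}X_n$ either some $X_n\in p$ or there is $A\in p$ with $|A\cap X_n|\le1$ for all $n$. For an ultrafilter $p$ on $\omega$ and ultrafilters $u_n$ on $Z$, $p\text{ - }\lim_n u_n=\{A\subseteq Z : \{n : A\in u_n\}\in p\}$. A sequence $\langle u_n\rangle$ is $p$-injective if there is $A\in p$ such that $u_n\ne u_m$ for all distinct $n,m\in A$. -}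

module Defs where

open import Level using (0ℓ)
open import Data.Nat using (ℕ)
open import Data.Bool using (Bool; true; false; not; _∧_)
open import Data.Product using (Σ; ∃; _×_)
open import Data.Sum using (_⊎_)
open import Data.Empty using (⊥)
open import Relation.Nullary using (¬_; Dec; does)
open import Relation.Unary using (Pred)
open import Relation.Binary.PropositionalEquality using (_≡_; _≢_)
open import Axiom.ExcludedMiddle using (ExcludedMiddle)

-- Subsets of a set X, as characteristic functions.  Under excluded
-- middle (a hypothesis of the theorem) this is the full power set.
Subset : Set → Set
Subset X = X → Bool

_∈ₛ_ : {X : Set} → X → Subset X → Set
x ∈ₛ A = A x ≡ true

_⊆ₛ_ : {X : Set} → Subset X → Subset X → Set
A ⊆ₛ B = ∀ x → x ∈ₛ A → x ∈ₛ B

_∩ₛ_ : {X : Set} → Subset X → Subset X → Subset X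
(A ∩ₛ B) x = A x ∧ B x

∁ₛ : {X : Set} → Subset X → Subset X
∁ₛ A x = not (A x)

fullₛ : {X : Set} → Subset X
fullₛ _ = true

emptyₛ : {X : Set} → Subset X
emptyₛ _ = false

⟦_∣_⟧ : {X : Set} → ExcludedMiddle 0ℓ → Pred X 0ℓ → Subset X
⟦ lem ∣ P ⟧ x = does (lem {P x})

Family : Set → Set₁
Family X = Subset X → Set

record IsUltrafilter {X : Set} (F : Family X) : Set where
  field
    full∈   : F fullₛ
    empty∉  : ¬ F emptyₛ
    upward  : ∀ {A B} → A ⊆ₛ B → F A → F B
    inter   : ∀ {A B} → F A → F B → F (A ∩ₛ B)
    ultra   : ∀ A → F A ⊎ F (∁ₛ A)

_≈U_ : {X : Set} → Family X → Family X → Set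
F ≈U G = ∀ A → (F A → G A) × (G A → F A)

IsPrincipal : {X : Set} → Family X → Set
IsPrincipal {X} F = ∃ λ (x : X) → ∀ A → (F A → x ∈ₛ A) × (x ∈ₛ A → F A)

-- a partition of ω into countably many (possibly empty) pieces
IsPartition : (ℕ → Subset ℕ) → Set
IsPartition X = (∀ m → ∃ λ n → m ∈ₛ X n)
              × (∀ m n n′ → m ∈ₛ X n → m ∈ₛ X n′ → n ≡ n′)

IsSelective : Family ℕ → Set
IsSelective p =
  IsUltrafilter p × ¬ IsPrincipal p ×
  (∀ (X : ℕ → Subset ℕ) → IsPartition X →
     (∃ λ n → p (X n)) ⊎
     (∃ λ A → p A × (∀ n a b → a ∈ₛ (A ∩ₛ X n) → b ∈ₛ (A ∩ₛ X n) → a ≡ b)))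

pLim : {Z : Set} → ExcludedMiddle 0ℓ → Family ℕ → (ℕ → Family Z) → Family Z
pLim lem p u A = p ⟦ lem ∣ (λ n → u n A) ⟧

IsPInjective : {Z : Set} → Family ℕ → (ℕ → Family Z) → Set
IsPInjective p u =
  ∃ λ A → p A × (∀ n m → n ∈ₛ A → m ∈ₛ A → n ≢ m → ¬ (u n ≈U u m))

{-# OPTIONS --safe #-}
-- Suppose the limits agree, W = p-lim u = p-lim v, but u n ≠ v n for p-many n.  By
-- p-injectivity we may also assume u n ≠ W and v n ≠ W, so there are sets Q n ∈ W lying in
-- neither u n nor v n.  Selectivity yields a diagonal set H ∈ p with Q n ∈ u m and Q n ∈ v m
-- whenever n < m in H, so that the sets K m = ∁ Q m ∩ ⋂ {Q n : n < m, n ∈ H} (m ∈ H) belong to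
-- both u m and v m and are pairwise disjoint.  Splitting each K m by a set S m ∈ u m ∖ v m gives
-- ⋃ (S m ∩ K m) ∈ p-lim u and ⋃ (∁ S m ∩ K m) ∈ p-lim v: disjoint members of W.
--
-- The diagonal set (for Y n ∈ p, some H ∈ p with m ∈ Y n whenever n < m in H) uses selectivity
-- twice: a selector A for the partition of ℕ by the first k with m ∉ Y k bounds the elements of
-- A of level < c by some B c, and a selector for a partition into blocks growing faster than B,
-- thinned to the blocks of one parity, keeps any two chosen points far enough apart.
module Submission where

open import Defs
open import Level using (0ℓ)
open import Function using (_∘_)
open import Data.Nat
  using (ℕ; zero; suc; _<_; _≤_; _⊔_; _≟_; _<?_; z≤n; s≤s; s≤s⁻¹; parity; _≤′_; ≤′-reflexive; ≤′-step)
open import Data.Nat.Properties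
open import Data.Parity.Base using (0ℙ; 1ℙ)
open import Data.Parity.Properties using (p≢p⁻¹; suc-homo-⁻¹) renaming (_≟_ to _≟ℙ_)
open import Data.Bool using (Bool; true; false; not; _∧_)
open import Data.Bool.Properties using (∧-conicalˡ; ∧-conicalʳ) renaming (_≟_ to _≟𝔹_)
open import Data.Product using (∃; _×_; _,_; proj₁; proj₂)
open import Data.Sum as Sum using (_⊎_; inj₁; inj₂)
open import Data.Empty using (⊥-elim)
open import Relation.Nullary using (¬_; Dec; yes; no; does)
open import Relation.Nullary.Decidable using (dec-true; decidable-stable)
open import Relation.Binary.PropositionalEquality using (_≡_; _≢_; refl; sym; trans; cong; cong₂; subst)
open import Relation.Binary.Definitions using (tri<; tri≈; tri>)
open import Axiom.ExcludedMiddle using (ExcludedMiddle)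

does⇒ : {A : Set} (a? : Dec A) → does a? ≡ true → A
does⇒ (yes a) _ = a

∧-true⁺ : ∀ {a b} → a ≡ true → b ≡ true → a ∧ b ≡ true
∧-true⁺ = cong₂ _∧_

∧-true⁻ : ∀ {a b} → a ∧ b ≡ true → a ≡ true × b ≡ true
∧-true⁻ {a} {b} a∧b = ∧-conicalˡ a b a∧b , ∧-conicalʳ a b a∧b

not-true⁻ : ∀ {a} → not a ≡ true → a ≢ true
not-true⁻ not-a a with () ← trans (sym not-a) (cong not a)

step-monotone : (s : ℕ → ℕ) → (∀ i → s i ≤ s (suc i)) → ∀ {i j} → i ≤ j → s i ≤ s j
step-monotone s step = go ∘ ≤⇒≤′
  where
  go : ∀ {i j} → i ≤′ j → s i ≤ s j
  go (≤′-reflexive refl) = ≤-refl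
  go (≤′-step i≤′j) = ≤-trans (go i≤′j) (step _)

parity-suc-≢ : ∀ i → parity (suc i) ≢ parity i
parity-suc-≢ i eq = p≢p⁻¹ (parity (suc i)) (trans eq (sym (suc-homo-⁻¹ i)))

module _ {X : Set} where

  Subsingleton : Subset X → Set
  Subsingleton K = ∀ a b → a ∈ₛ K → b ∈ₛ K → a ≡ b

  ≈U-sym : {F G : Family X} → F ≈U G → G ≈U F
  ≈U-sym F≈G A = proj₂ (F≈G A) , proj₁ (F≈G A)

  ≈U-trans : {F G K : Family X} → F ≈U G → G ≈U K → F ≈U K
  ≈U-trans F≈G G≈K A = proj₁ (G≈K A) ∘ proj₁ (F≈G A) , proj₂ (F≈G A) ∘ proj₂ (G≈K A)

module Ultrafilter {X : Set} {F : Family X} (U : IsUltrafilter F) where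
  open IsUltrafilter U public

  empty-∉ : ∀ {A} → (∀ x → ¬ x ∈ₛ A) → ¬ F A
  empty-∉ A-empty A∈ = empty∉ (upward (λ x x∈A → ⊥-elim (A-empty x x∈A)) A∈)

  disjoint-∉ : ∀ {A B} → (∀ x → x ∈ₛ A → ¬ x ∈ₛ B) → F A → ¬ F B
  disjoint-∉ A∩B-empty A∈ B∈ =
    empty-∉ (λ x x∈ → let (x∈A , x∈B) = ∧-true⁻ x∈ in A∩B-empty x x∈A x∈B) (inter A∈ B∈)

  ∉⇒∁∈ : ∀ {A} → ¬ F A → F (∁ₛ A)
  ∉⇒∁∈ {A} A∉ = Sum.[ (λ A∈ → ⊥-elim (A∉ A∈)) , (λ ∁A∈ → ∁A∈) ]′ (ultra A)

  ∁∈⇒∉ : ∀ {A} → F (∁ₛ A) → ¬ F A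
  ∁∈⇒∉ = disjoint-∉ (λ _ → not-true⁻)

  parity-constant : (f : X → ℕ)
                  → ∃ λ P → F P × (∀ a b → a ∈ₛ P → b ∈ₛ P → parity (f a) ≡ parity (f b))
  parity-constant f with ultra (λ x → does (parity (f x) ≟ℙ 0ℙ))
  ... | inj₁ even∈ = _ , even∈ , λ a b a∈ b∈ →
    trans (does⇒ (_ ≟ℙ 0ℙ) a∈) (sym (does⇒ (_ ≟ℙ 0ℙ) b∈))
  ... | inj₂ odd∈ = _ , odd∈ , λ a b a∈ b∈ → trans (odd a a∈) (sym (odd b b∈))
    where
    ≢0ℙ⇒≡1ℙ : ∀ {q} → q ≢ 0ℙ → q ≡ 1ℙ
    ≢0ℙ⇒≡1ℙ {0ℙ} q≢0ℙ = ⊥-elim (q≢0ℙ refl)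
    ≢0ℙ⇒≡1ℙ {1ℙ} _ = refl
    odd : ∀ a → a ∈ₛ ∁ₛ (λ x → does (parity (f x) ≟ℙ 0ℙ)) → parity (f a) ≡ 1ℙ
    odd a a∈ = ≢0ℙ⇒≡1ℙ (not-true⁻ a∈ ∘ dec-true (_ ≟ℙ 0ℙ))

module NonPrincipal {X : Set} {F : Family X} (U : IsUltrafilter F) (nonprincipal : ¬ IsPrincipal F) where
  open Ultrafilter U

  subsingleton-∉ : ∀ {K} → Subsingleton K → ¬ F K
  subsingleton-∉ {K} K-sub K∈ = empty-∉ (λ x x∈K → nonprincipal (x , generates x x∈K)) K∈
    where
    generates : ∀ x → x ∈ₛ K → ∀ A → (F A → x ∈ₛ A) × (x ∈ₛ A → F A)
    generates x x∈K A =
        (λ A∈ → decidable-stable (A x ≟𝔹 true) λ x∉A →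
                  disjoint-∉ (λ y y∈K y∈A → x∉A (subst (_∈ₛ A) (K-sub y x y∈K x∈K) y∈A)) K∈ A∈)
      , (λ x∈A → upward (λ y y∈K → subst (_∈ₛ A) (K-sub x y x∈K y∈K) x∈A) K∈)

module NonPrincipalℕ {p : Family ℕ} (U : IsUltrafilter p) (nonprincipal : ¬ IsPrincipal p) where
  open Ultrafilter U
  open NonPrincipal U nonprincipal

  bounded-∉ : ∀ c {K} → (∀ m → m ∈ₛ K → m < c) → ¬ p K
  bounded-∉ zero K<0 = empty-∉ (λ m m∈K → n≮0 (K<0 m m∈K))
  bounded-∉ (suc c) {K} K≤c K∈ with ultra (λ m → does (m ≟ c))
  ... | inj₁ c∈ =
    subsingleton-∉ (λ a b a≡c b≡c → trans (does⇒ (a ≟ c) a≡c) (sym (does⇒ (b ≟ c) b≡c))) c∈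
  ... | inj₂ ≢c∈ = bounded-∉ c K<c (inter K∈ ≢c∈)
    where
    K<c : ∀ m → m ∈ₛ (K ∩ₛ ∁ₛ (λ m → does (m ≟ c))) → m < c
    K<c m m∈ = let (m∈K , m≢c) = ∧-true⁻ m∈
               in ≤∧≢⇒< (s≤s⁻¹ (K≤c m m∈K)) (not-true⁻ m≢c ∘ dec-true (m ≟ c))

fibre : (ℕ → ℕ) → ℕ → Subset ℕ
fibre f k m = does (f m ≟ k)

fibre-partition : (f : ℕ → ℕ) → IsPartition (fibre f)
fibre-partition f =
    (λ m → f m , dec-true (f m ≟ f m) refl)
  , (λ m k k′ m∈k m∈k′ → trans (sym (does⇒ (f m ≟ k) m∈k)) (does⇒ (f m ≟ k′) m∈k′))

InjectiveOn : (ℕ → ℕ) → Subset ℕ → Set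
InjectiveOn f A = ∀ a b → a ∈ₛ A → b ∈ₛ A → f a ≡ f b → a ≡ b

selective⇒injectiveOn : ∀ {p} → IsSelective p → (f : ℕ → ℕ) → (∀ k → ¬ p (fibre f k))
                      → ∃ λ A → p A × InjectiveOn f A
selective⇒injectiveOn (_ , _ , select) f fibre∉ with select (fibre f) (fibre-partition f)
... | inj₁ (k , fibre∈) = ⊥-elim (fibre∉ k fibre∈)
... | inj₂ (A , A∈ , selects) = A , A∈ , λ a b a∈A b∈A fa≡fb →
  selects (f a) a b (∧-true⁺ a∈A (dec-true (f a ≟ f a) refl))
                    (∧-true⁺ b∈A (dec-true (f b ≟ f a) (sym fa≡fb)))

firstFalse : (ℕ → Bool) → ℕ → ℕ
firstFalse b zero = zero
firstFalse b (suc c) with b zero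
... | true = suc (firstFalse (b ∘ suc) c)
... | false = zero

<firstFalse⇒true : ∀ b c k → k < firstFalse b c → b k ≡ true
<firstFalse⇒true b (suc c) k k< with b zero in b0
<firstFalse⇒true b (suc c) zero _ | true = b0
<firstFalse⇒true b (suc c) (suc k) k< | true = <firstFalse⇒true (b ∘ suc) c k (s≤s⁻¹ k<)

firstFalse-stops : ∀ b c → firstFalse b c ≡ c ⊎ b (firstFalse b c) ≡ false
firstFalse-stops b zero = inj₁ refl
firstFalse-stops b (suc c) with b zero in b0
... | false = inj₂ b0
... | true = Sum.map₁ (cong suc) (firstFalse-stops (b ∘ suc) c)

exitLevel : (ℕ → Subset ℕ) → ℕ → ℕ
exitLevel Y m = firstFalse (λ k → Y k m) m

exitLevel-fibre⊆ : ∀ Y k m → m ∈ₛ (fibre (exitLevel Y) k ∩ₛ Y k) → m ≡ k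
exitLevel-fibre⊆ Y k m m∈ with ∧-true⁻ m∈
... | level≡k , m∈Yk with does⇒ (exitLevel Y m ≟ k) level≡k | firstFalse-stops (λ j → Y j m) m
...   | refl | inj₁ level≡m = sym level≡m
...   | refl | inj₂ m∉Y with () ← trans (sym m∈Yk) m∉Y

exitLevel-fibre∉ : ∀ {p} → IsUltrafilter p → ¬ IsPrincipal p → ∀ {Y} → (∀ n → p (Y n))
                 → ∀ k → ¬ p (fibre (exitLevel Y) k)
exitLevel-fibre∉ U nonprincipal {Y} Y∈ k fibre∈ =
  subsingleton-∉ (λ a b a∈ b∈ → trans (exitLevel-fibre⊆ Y k a a∈) (sym (exitLevel-fibre⊆ Y k b b∈)))
                 (IsUltrafilter.inter U fibre∈ (Y∈ k))
  where open NonPrincipal U nonprincipal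

module _ (lem : ExcludedMiddle 0ℓ) where

  subsingleton-bounded : ∀ {K : Subset ℕ} → Subsingleton K → ∃ λ b → ∀ m → m ∈ₛ K → m < b
  subsingleton-bounded {K} K-sub with lem {∃ λ k → k ∈ₛ K}
  ... | yes (k , k∈K) = suc k , λ m m∈K → s≤s (≤-reflexive (K-sub m k m∈K k∈K))
  ... | no ∄k = 0 , λ m m∈K → ⊥-elim (∄k (m , m∈K))

  injectiveOn⇒preimage-bounded : ∀ {f A} → InjectiveOn f A
    → ∃ λ (B : ℕ → ℕ) → (∀ {c d} → c ≤ d → B c ≤ B d)
                      × (∀ c m → m ∈ₛ A → f m < c → m < B c)
  injectiveOn⇒preimage-bounded {f} {A} injective = B , step-monotone B (λ c → m≤m⊔n (B c) _) , <B
    where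
    fibre-bounded : ∀ c → ∃ λ b → ∀ m → m ∈ₛ (A ∩ₛ fibre f c) → m < b
    fibre-bounded c = subsingleton-bounded λ a b a∈ b∈ →
      let (a∈A , fa≡c) = ∧-true⁻ a∈ ; (b∈A , fb≡c) = ∧-true⁻ b∈
      in injective a b a∈A b∈A (trans (does⇒ (f a ≟ c) fa≡c) (sym (does⇒ (f b ≟ c) fb≡c)))
    B : ℕ → ℕ
    B zero = zero
    B (suc c) = B c ⊔ proj₁ (fibre-bounded c)
    <B : ∀ c m → m ∈ₛ A → f m < c → m < B c
    <B (suc c) m m∈A fm<1+c with m≤n⇒m<n∨m≡n (s≤s⁻¹ fm<1+c)
    ... | inj₁ fm<c = <-≤-trans (<B c m m∈A fm<c) (m≤m⊔n (B c) _)
    ... | inj₂ fm≡c = <-≤-trans (proj₂ (fibre-bounded c) m (∧-true⁺ m∈A (dec-true (f m ≟ c) fm≡c)))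
                                (m≤n⊔m (B c) _)

  module Sparse {p : Family ℕ} (selective : IsSelective p)
                (h : ℕ → ℕ) (h-mono : ∀ {a b} → a ≤ b → h a ≤ h b) where
    open Ultrafilter (proj₁ selective)
    open NonPrincipalℕ (proj₁ selective) (proj₁ (proj₂ selective))

    cut : ℕ → ℕ
    cut zero = zero
    cut (suc i) = suc (cut i) ⊔ h (cut i)

    cut-strict : ∀ i → cut i < cut (suc i)
    cut-strict i = m≤m⊔n (suc (cut i)) (h (cut i))

    block : ℕ → ℕ
    block zero = zero
    block (suc n) with suc n <? cut (suc (block n))
    ... | yes _ = block n
    ... | no _ = suc (block n)

    block-bounds : ∀ n → cut (block n) ≤ n × n < cut (suc (block n))
    block-bounds zero = z≤n , cut-strict 0
    block-bounds (suc n) with suc n <? cut (suc (block n)) | block-bounds n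
    ... | yes n+1<cut | (cut≤n , _) = m≤n⇒m≤1+n cut≤n , n+1<cut
    ... | no n+1≮cut | (_ , n<cut) = ≮⇒≥ n+1≮cut , ≤-<-trans n<cut (cut-strict (suc (block n)))

    block-step : ∀ n → block n ≤ block (suc n)
    block-step n with suc n <? cut (suc (block n))
    ... | yes _ = ≤-refl
    ... | no _ = n≤1+n _

    block-fibre∉ : ∀ i → ¬ p (fibre block i)
    block-fibre∉ i = bounded-∉ (cut (suc i)) λ n n∈ →
      subst (λ j → n < cut (suc j)) (does⇒ (block n ≟ i) n∈) (proj₂ (block-bounds n))

    -- Points selected from adjacent blocks may be too close to each other; this is why
    -- only blocks of one parity are kept.
    two-blocks-apart : ∀ {A P} → InjectiveOn block A
      → (∀ a b → a ∈ₛ P → b ∈ₛ P → parity (block a) ≡ parity (block b))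
      → ∀ n m → n ∈ₛ (A ∩ₛ P) → m ∈ₛ (A ∩ₛ P) → n < m → suc (suc (block n)) ≤ block m
    two-blocks-apart injective same-parity n m n∈ m∈ n<m with ∧-true⁻ n∈ | ∧-true⁻ m∈
    ... | n∈A , n∈P | m∈A , m∈P = ≤∧≢⇒< block-n<block-m λ eq →
      parity-suc-≢ (block n) (trans (cong parity eq) (sym (same-parity n m n∈P m∈P)))
      where
      block-n<block-m : block n < block m
      block-n<block-m = ≤∧≢⇒< (step-monotone block block-step (<⇒≤ n<m))
                              (λ eq → <-irrefl (injective n m n∈A m∈A eq) n<m)

    sparse : ∃ λ S → p S × (∀ n m → n ∈ₛ S → m ∈ₛ S → n < m → h n ≤ m)
    sparse with selective⇒injectiveOn selective block block-fibre∉ | parity-constant block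
    ... | A , A∈ , injective | P , P∈ , same-parity = A ∩ₛ P , inter A∈ P∈ , λ n m n∈ m∈ n<m →
      let open ≤-Reasoning in begin
        h n                        ≤⟨ h-mono (<⇒≤ (proj₂ (block-bounds n))) ⟩
        h (cut (suc (block n)))    ≤⟨ m≤n⊔m _ _ ⟩
        cut (suc (suc (block n)))  ≤⟨ step-monotone cut (<⇒≤ ∘ cut-strict)
                                        (two-blocks-apart injective same-parity n m n∈ m∈ n<m) ⟩
        cut (block m)              ≤⟨ proj₁ (block-bounds m) ⟩
        m                          ∎

  diagonal : ∀ {p} → IsSelective p → (Y : ℕ → Subset ℕ) → (∀ n → p (Y n))
           → ∃ λ H → p H × (∀ n m → n ∈ₛ H → m ∈ₛ H → n < m → m ∈ₛ Y n)
  diagonal selective@(U , nonprincipal , _) Y Y∈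
    with selective⇒injectiveOn selective (exitLevel Y) (exitLevel-fibre∉ U nonprincipal Y∈)
  ... | A , A∈ , injective with injectiveOn⇒preimage-bounded injective
  ... | B , B-mono , <B with Sparse.sparse selective (B ∘ suc) (B-mono ∘ s≤s)
  ... | S , S∈ , sparse = A ∩ₛ S , IsUltrafilter.inter U A∈ S∈ , λ n m n∈ m∈ n<m →
    let (m∈A , m∈S) = ∧-true⁻ m∈ in
    <firstFalse⇒true (λ k → Y k m) m n (≰⇒> λ level≤n →
      <-irrefl refl (<-≤-trans (<B (suc n) m m∈A (s≤s level≤n)) (sparse n m (proj₂ (∧-true⁻ n∈)) m∈S n<m)))

  ⋂< : {X : Set} → (ℕ → Set) → (ℕ → Subset X) → ℕ → Subset X
  ⋂< P Q m = ⟦ lem ∣ (λ z → ∀ n → n < m → P n → z ∈ₛ Q n) ⟧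

  ⋃ : {X : Set} → Subset ℕ → (ℕ → Subset X) → Subset X
  ⋃ H C = ⟦ lem ∣ (λ z → ∃ λ m → m ∈ₛ H × z ∈ₛ C m) ⟧

  disjointify : {X : Set} → Subset ℕ → (ℕ → Subset X) → ℕ → Subset X
  disjointify H Q m = ∁ₛ (Q m) ∩ₛ ⋂< (_∈ₛ H) Q m

  PairwiseDisjointOn : {X : Set} → Subset ℕ → (ℕ → Subset X) → Set
  PairwiseDisjointOn H K = ∀ m n z → m ∈ₛ H → n ∈ₛ H → z ∈ₛ K m → z ∈ₛ K n → m ≡ n

  disjointify-disjoint : ∀ {X} H (Q : ℕ → Subset X) → PairwiseDisjointOn H (disjointify H Q)
  disjointify-disjoint H Q m n z m∈H n∈H z∈m z∈n with <-cmp m n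
  ... | tri< m<n _ _ =
    ⊥-elim (not-true⁻ (proj₁ (∧-true⁻ z∈m)) (does⇒ lem (proj₂ (∧-true⁻ z∈n)) m m<n m∈H))
  ... | tri≈ _ m≡n _ = m≡n
  ... | tri> _ _ n<m =
    ⊥-elim (not-true⁻ (proj₁ (∧-true⁻ z∈n)) (does⇒ lem (proj₂ (∧-true⁻ z∈m)) n n<m n∈H))

  module _ {X : Set} {F : Family X} (U : IsUltrafilter F) where
    open Ultrafilter U

    ⋂<-∈ : ∀ {P Q} m → (∀ n → n < m → P n → F (Q n)) → F (⋂< P Q m)
    ⋂<-∈ zero _ = upward (λ z _ → dec-true lem λ n ()) full∈
    ⋂<-∈ {P} {Q} (suc m) Q∈ = upward extend (inter (⋂<-∈ m (λ n n<m → Q∈ n (m<n⇒m<1+n n<m))) last∈)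
      where
      last∈ : F ⟦ lem ∣ (λ z → P m → z ∈ₛ Q m) ⟧
      last∈ with lem {P m}
      ... | yes Pm = upward (λ z z∈Qm → dec-true lem λ _ → z∈Qm) (Q∈ m ≤-refl Pm)
      ... | no ¬Pm = upward (λ z _ → dec-true lem λ Pm → ⊥-elim (¬Pm Pm)) full∈
      extend : (⋂< P Q m ∩ₛ ⟦ lem ∣ (λ z → P m → z ∈ₛ Q m) ⟧) ⊆ₛ ⋂< P Q (suc m)
      extend z z∈ with ∧-true⁻ z∈
      ... | z∈⋂ , z∈last = dec-true lem λ n n<1+m Pn →
        Sum.[ (λ n<m → does⇒ lem z∈⋂ n n<m Pn) , (λ { refl → does⇒ lem z∈last Pn }) ]′
          (m≤n⇒m<n∨m≡n (s≤s⁻¹ n<1+m))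

    separator : ∀ {G} → IsUltrafilter G → ∃ λ A → F A × (¬ (F ≈U G) → ¬ G A)
    separator {G} GU with lem {∃ λ A → F A × ¬ G A}
    ... | yes (A , A∈F , A∉G) = A , A∈F , λ _ → A∉G
    ... | no ∄A = fullₛ , full∈ , λ F≉G _ → F≉G λ A → F⊆G A , G⊆F A
      where
      F⊆G : ∀ A → F A → G A
      F⊆G A A∈F = decidable-stable lem λ A∉G → ∄A (A , A∈F , A∉G)
      G⊆F : ∀ A → G A → F A
      G⊆F A A∈G = decidable-stable lem λ A∉F →
        Ultrafilter.∁∈⇒∉ GU (F⊆G (∁ₛ A) (∉⇒∁∈ A∉F)) A∈G

  module _ {p : Family ℕ} (pU : IsUltrafilter p) where
    open Ultrafilter pU

    pLim-intro : ∀ {Z} (w : ℕ → Family Z) {A N} → p N → (∀ n → n ∈ₛ N → w n A) → pLim lem p w A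
    pLim-intro w N∈ N⇒ = upward (λ n n∈N → dec-true lem (N⇒ n n∈N)) N∈

    pLim-isUltrafilter : ∀ {Z} {w : ℕ → Family Z} → (∀ n → IsUltrafilter (w n)) → IsUltrafilter (pLim lem p w)
    pLim-isUltrafilter {w = w} wU = record
      { full∈  = pLim-intro w full∈ λ n _ → Ultrafilter.full∈ (wU n)
      ; empty∉ = empty-∉ λ n n∈ → Ultrafilter.empty∉ (wU n) (does⇒ lem n∈)
      ; upward = λ A⊆B A∈ → pLim-intro w A∈ λ n n∈ → Ultrafilter.upward (wU n) A⊆B (does⇒ lem n∈)
      ; inter  = λ A∈ B∈ → pLim-intro w (inter A∈ B∈) λ n n∈ →
                   Ultrafilter.inter (wU n) (does⇒ lem (proj₁ (∧-true⁻ n∈)))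
                                            (does⇒ lem (proj₂ (∧-true⁻ n∈)))
      ; ultra  = λ A → Sum.map₂ (λ ∁∈ → pLim-intro w ∁∈ λ n n∈ →
                   Ultrafilter.∉⇒∁∈ (wU n) (not-true⁻ n∈ ∘ dec-true lem)) (ultra _)
      }

    pLim-cong : ∀ {Z} {u v : ℕ → Family Z}
              → p ⟦ lem ∣ (λ n → u n ≈U v n) ⟧ → pLim lem p u ≈U pLim lem p v
    pLim-cong u≈v∈ A =
      transfer u≈v∈ , transfer (upward (λ n n∈ → dec-true lem (≈U-sym (does⇒ lem n∈))) u≈v∈)
      where
      transfer : ∀ {u v} → p ⟦ lem ∣ (λ n → u n ≈U v n) ⟧ → pLim lem p u A → pLim lem p v A
      transfer {v = v} u≈v∈ A∈ = pLim-intro v (inter A∈ u≈v∈) λ n n∈ →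
        proj₁ (does⇒ lem (proj₂ (∧-true⁻ n∈)) A) (does⇒ lem (proj₁ (∧-true⁻ n∈)))

    ⋃-∈-pLim : ∀ {Z} {w : ℕ → Family Z} {H C} → (∀ n → IsUltrafilter (w n))
             → p H → (∀ m → m ∈ₛ H → w m (C m)) → pLim lem p w (⋃ H C)
    ⋃-∈-pLim {w = w} wU H∈ C∈ = pLim-intro w H∈ λ m m∈H →
      Ultrafilter.upward (wU m) (λ z z∈C → dec-true lem (m , m∈H , z∈C)) (C∈ m m∈H)

    pInjective⇒almost-≉ : ¬ IsPrincipal p → ∀ {Z} {w : ℕ → Family Z} → IsPInjective p w → ∀ G
                        → p ⟦ lem ∣ (λ n → ¬ (G ≈U w n)) ⟧
    pInjective⇒almost-≉ nonprincipal {w = w} (I , I∈ , injective) G = decidable-stable lem λ ≉∉ →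
      NonPrincipal.subsingleton-∉ pU nonprincipal at-most-one (inter I∈ (∉⇒∁∈ ≉∉))
      where
      ≈G : ∀ n → n ∈ₛ ∁ₛ ⟦ lem ∣ (λ n → ¬ (G ≈U w n)) ⟧ → G ≈U w n
      ≈G n n∈ = decidable-stable lem (not-true⁻ n∈ ∘ dec-true lem)
      at-most-one : Subsingleton (I ∩ₛ ∁ₛ ⟦ lem ∣ (λ n → ¬ (G ≈U w n)) ⟧)
      at-most-one a b a∈ b∈ with ∧-true⁻ a∈ | ∧-true⁻ b∈
      ... | a∈I , a≈ | b∈I , b≈ = decidable-stable (a ≟ b) λ a≢b →
        injective a b a∈I b∈I a≢b (≈U-trans (≈U-sym (≈G a a≈)) (≈G b b≈))

    module _ {Z : Set} {u v : ℕ → Family Z}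
             (uU : ∀ n → IsUltrafilter (u n)) (vU : ∀ n → IsUltrafilter (v n)) where

      pairwiseDisjoint⇒pLim-≉ : ∀ {H K} → p H → PairwiseDisjointOn H K
        → (∀ m → m ∈ₛ H → u m (K m) × v m (K m) × ¬ (u m ≈U v m)) → ¬ (pLim lem p u ≈U pLim lem p v)
      pairwiseDisjoint⇒pLim-≉ {H} {K} H∈ K-disjoint K∈ u≈v =
        Ultrafilter.disjoint-∉ (pLim-isUltrafilter uU) C∩E=∅
          (⋃-∈-pLim uU H∈ C∈) (proj₂ (u≈v (⋃ H E)) (⋃-∈-pLim vU H∈ E∈))
        where
        S : ℕ → Subset Z
        S m = proj₁ (separator (uU m) (vU m))
        C E : ℕ → Subset Z
        C m = S m ∩ₛ K m
        E m = ∁ₛ (S m) ∩ₛ K m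
        C∈ : ∀ m → m ∈ₛ H → u m (C m)
        C∈ m m∈H = Ultrafilter.inter (uU m) (proj₁ (proj₂ (separator (uU m) (vU m)))) (proj₁ (K∈ m m∈H))
        E∈ : ∀ m → m ∈ₛ H → v m (E m)
        E∈ m m∈H with K∈ m m∈H
        ... | _ , Km∈v , u≉v = Ultrafilter.inter (vU m)
                (Ultrafilter.∉⇒∁∈ (vU m) (proj₂ (proj₂ (separator (uU m) (vU m))) u≉v)) Km∈v
        C∩E=∅ : ∀ z → z ∈ₛ ⋃ H C → ¬ z ∈ₛ ⋃ H E
        C∩E=∅ z z∈C z∈E with does⇒ lem z∈C | does⇒ lem z∈E
        ... | m , m∈H , z∈Cm | n , n∈H , z∈En with ∧-true⁻ z∈Cm | ∧-true⁻ z∈En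
        ... | z∈S , z∈Km | z∉S , z∈Kn with K-disjoint m n z m∈H n∈H z∈Km z∈Kn
        ... | refl = not-true⁻ z∉S z∈S

      private
        separatorᵘ : ∀ n → ∃ λ A → pLim lem p u A × (¬ (pLim lem p u ≈U u n) → ¬ u n A)
        separatorᵘ n = separator (pLim-isUltrafilter uU) (uU n)
        separatorᵛ : ∀ n → ∃ λ A → pLim lem p v A × (¬ (pLim lem p v ≈U v n) → ¬ v n A)
        separatorᵛ n = separator (pLim-isUltrafilter vU) (vU n)

      limitSet : ℕ → Subset Z
      limitSet n = proj₁ (separatorᵘ n) ∩ₛ proj₁ (separatorᵛ n)

      limitSet-∈ : pLim lem p u ≈U pLim lem p v → ∀ n → pLim lem p u (limitSet n) × pLim lem p v (limitSet n)
      limitSet-∈ u≈v n = ∈u , proj₁ (u≈v (limitSet n)) ∈u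
        where
        ∈u : pLim lem p u (limitSet n)
        ∈u = IsUltrafilter.inter (pLim-isUltrafilter uU) (proj₁ (proj₂ (separatorᵘ n)))
                                                        (proj₂ (u≈v _) (proj₁ (proj₂ (separatorᵛ n))))

      limitSet-∉ : ∀ n → ¬ (pLim lem p u ≈U u n) → ¬ (pLim lem p v ≈U v n)
                 → ¬ u n (limitSet n) × ¬ v n (limitSet n)
      limitSet-∉ n u≉ v≉ =
          (λ ∈u → proj₂ (proj₂ (separatorᵘ n)) u≉ (Ultrafilter.upward (uU n) (λ _ → proj₁ ∘ ∧-true⁻) ∈u))
        , (λ ∈v → proj₂ (proj₂ (separatorᵛ n)) v≉ (Ultrafilter.upward (vU n) (λ _ → proj₂ ∘ ∧-true⁻) ∈v))

      hits : ℕ → Subset ℕ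
      hits n = ⟦ lem ∣ (λ m → u m (limitSet n) × v m (limitSet n)) ⟧

      hits-∈ : pLim lem p u ≈U pLim lem p v → ∀ n → p (hits n)
      hits-∈ u≈v n =
        upward (λ m m∈ → dec-true lem (does⇒ lem (proj₁ (∧-true⁻ m∈)) , does⇒ lem (proj₂ (∧-true⁻ m∈))))
               (inter (proj₁ (limitSet-∈ u≈v n)) (proj₂ (limitSet-∈ u≈v n)))

      disjointify-∈ : ∀ {H} → (∀ n m → n ∈ₛ H → m ∈ₛ H → n < m → m ∈ₛ hits n)
        → ∀ m → m ∈ₛ H → ¬ (pLim lem p u ≈U u m) → ¬ (pLim lem p v ≈U v m)
        → u m (disjointify H limitSet m) × v m (disjointify H limitSet m)
      disjointify-∈ {H} diagonal-on m m∈H u≉ v≉ =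
          Ultrafilter.inter (uU m) (Ultrafilter.∉⇒∁∈ (uU m) (proj₁ (limitSet-∉ m u≉ v≉)))
                            (⋂<-∈ (uU m) m (λ n n<m n∈H → proj₁ (earlier n n<m n∈H)))
        , Ultrafilter.inter (vU m) (Ultrafilter.∉⇒∁∈ (vU m) (proj₂ (limitSet-∉ m u≉ v≉)))
                            (⋂<-∈ (vU m) m (λ n n<m n∈H → proj₂ (earlier n n<m n∈H)))
        where
        earlier : ∀ n → n < m → n ∈ₛ H → u m (limitSet n) × v m (limitSet n)
        earlier n n<m n∈H = does⇒ lem (diagonal-on n m n∈H m∈H n<m)

      almost-≉⇒pLim-≉ : IsSelective p → ∀ {D} → p D
        → (∀ n → n ∈ₛ D → ¬ (u n ≈U v n) × ¬ (pLim lem p u ≈U u n) × ¬ (pLim lem p v ≈U v n))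
        → ¬ (pLim lem p u ≈U pLim lem p v)
      almost-≉⇒pLim-≉ selective {D} D∈ D≉ u≈v =
        let (H , H∈ , diagonal-on) = diagonal selective hits (hits-∈ u≈v)
            diagonal-on-D : ∀ n m → n ∈ₛ (H ∩ₛ D) → m ∈ₛ (H ∩ₛ D) → n < m → m ∈ₛ hits n
            diagonal-on-D n m n∈ m∈ = diagonal-on n m (proj₁ (∧-true⁻ n∈)) (proj₁ (∧-true⁻ m∈))
        in pairwiseDisjoint⇒pLim-≉ (inter H∈ D∈) (disjointify-disjoint _ limitSet) (λ m m∈ →
             let (u≉v , u≉ , v≉) = D≉ m (proj₂ (∧-true⁻ m∈))
                 (K∈u , K∈v) = disjointify-∈ diagonal-on-D m m∈ u≉ v≉
             in K∈u , K∈v , u≉v) u≈v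

      pLim-cong⁻¹ : IsSelective p → IsPInjective p u → IsPInjective p v
        → pLim lem p u ≈U pLim lem p v → p ⟦ lem ∣ (λ n → u n ≈U v n) ⟧
      pLim-cong⁻¹ selective@(_ , nonprincipal , _) u-injective v-injective u≈v = decidable-stable lem λ ≈∉ →
        almost-≉⇒pLim-≉ selective
          (inter (∉⇒∁∈ ≈∉) (inter (pInjective⇒almost-≉ nonprincipal u-injective _)
                                  (pInjective⇒almost-≉ nonprincipal v-injective _)))
          (λ n n∈ → let (≉ , u≉∧v≉) = ∧-true⁻ n∈ ; (u≉ , v≉) = ∧-true⁻ u≉∧v≉
                    in not-true⁻ ≉ ∘ dec-true lem , does⇒ lem u≉ , does⇒ lem v≉)
          u≈v

theorem3p6 : (lem : ExcludedMiddle 0ℓ)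
    → (p : Family ℕ) → IsSelective p
    → (Z : Set) → (u v : ℕ → Family Z)
    → (∀ n → IsUltrafilter (u n)) → (∀ n → IsUltrafilter (v n))
    → IsPInjective p u → IsPInjective p v
    → (pLim lem p u ≈U pLim lem p v → p ⟦ lem ∣ (λ n → u n ≈U v n) ⟧)
      × (p ⟦ lem ∣ (λ n → u n ≈U v n) ⟧ → pLim lem p u ≈U pLim lem p v)
theorem3p6 lem p selective Z u v uU vU u-injective v-injective =
    pLim-cong⁻¹ lem (proj₁ selective) uU vU selective u-injective v-injective
  , pLim-cong lem (proj₁ selective)
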